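{- Let $N\ge1$ be an integer, let $\Gamma=\Gamma_0(N)$, and let $c$ be the complex conjugation $c(z)=1/(N\bar z)$ of the upper half-plane $\mathfrak{h}$. Let $\gamma\in\Gamma$ be admissible for $c$. Then $C_\gamma=\{z\in\mathfrak{h}\cup\mathbf{Q}\mathbf{P}^1:\gamma z=cz\}$ contains a cusp if and only if $N$ is a perfect square.
   Context: $\Gamma_0(N)$ is the image in $\mathrm{PSL}_2(\mathbf{Z})$ of integer matrices of determinant 1 with lower-left entry divisible by $N$; it is stable under $\gamma\mapsto\gamma^c:=c\gamma c$. An element $\gamma$ is admissible for $c$ if $\gamma^c=\gamma^{ -1}$. The cusps of $\Gamma$ are the points of $\mathbf{Q}\mathbf{P}^1$, and $c$ is extended to $\mathbf{R}\mathbf{P}^1$ by the same formula. -}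

module Defs where

open import Data.Nat using (ℕ)
open import Data.Integer using (ℤ; +_; _+_; _-_; _*_; -_)
open import Data.Integer.Divisibility using (_∣_)
open import Data.Product using (_×_; ∃; _,_)
open import Data.Sum using (_⊎_)
open import Relation.Binary.PropositionalEquality using (_≡_)
open import Relation.Nullary using (¬_)

record Mat : Set where
  constructor mat
  field
    a b c d : ℤ
open Mat public

_·_ : Mat → Mat → Mat
mat a₁ b₁ c₁ d₁ · mat a₂ b₂ c₂ d₂ =
  mat (a₁ * a₂ + b₁ * c₂) (a₁ * b₂ + b₁ * d₂)
      (c₁ * a₂ + d₁ * c₂) (c₁ * b₂ + d₁ * d₂)

det : Mat → ℤ
det (mat a b c d) = a * d - b * c

_⊙_ : ℤ → Mat → Mat
k ⊙ mat a b c d = mat (k * a) (k * b) (k * c) (k * d)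

adj : Mat → Mat
adj (mat a b c d) = mat d (- b) (- c) a

-- a matrix representing an element of Γ₀(N) ⊆ PSL₂(ℤ)
-- (elements of PSL₂ are matrices up to sign; all notions below are sign-invariant)
InΓ₀ : ℕ → Mat → Set
InΓ₀ N γ = det γ ≡ + 1 × (+ N) ∣ c γ

-- W = (0 1 ; N 0): c(z) = W·(conj z) = 1/(N z̄)
W : ℕ → Mat
W N = mat (+ 0) (+ 1) (+ N) (+ 0)

-- γ^c = c γ c is the Möbius map of W γ W, which as an element of PSL₂(ℝ)
-- is (1/N)·WγW.  Hence γ^c = γ⁻¹ in PSL₂ iff WγW = ± N·γ⁻¹ = ± N·adj γ.
Admissible : ℕ → Mat → Set
Admissible N γ =
  (W N · γ) · W N ≡ (+ N) ⊙ adj γ ⊎ (W N · γ) · W N ≡ (- (+ N)) ⊙ adj γ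

-- Points of ℚℙ¹: nonzero integer pairs (p : q), i.e. p/q, up to scaling.
NonZeroPair : ℤ × ℤ → Set
NonZeroPair (p , q) = ¬ (p ≡ + 0 × q ≡ + 0)

infix 4 _≈ℙ_
_≈ℙ_ : ℤ × ℤ → ℤ × ℤ → Set
(p₁ , q₁) ≈ℙ (p₂ , q₂) = p₁ * q₂ ≡ p₂ * q₁

act : Mat → ℤ × ℤ → ℤ × ℤ
act (mat a b c d) (p , q) = (a * p + b * q , c * p + d * q)

-- the conjugation c restricted to ℚℙ¹ ⊆ ℝℙ¹ : x ↦ 1/(N x), i.e. (p : q) ↦ (q : N p)
cP : ℕ → ℤ × ℤ → ℤ × ℤ
cP N (p , q) = (q , (+ N) * p)

CγHasCusp : ℕ → Mat → Set
CγHasCusp N γ = ∃ λ x → NonZeroPair x × (act γ x ≈ℙ cP N x)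

IsSquare : ℕ → Set
IsSquare N = ∃ λ m → N ≡ m Data.Nat.* m

-- For admissible γ the relation γ^c = γ⁻¹ pins γ down to the shape (a b ; -N b d) with
-- a d + N b² = 1 (the other sign would make det γ negative). The cusps x = p/q with γ x = c x
-- are then the rational roots of the binary quadratic form N a p² + 2 N b p q - d q², whose
-- discriminant (N b)² + N a d is N · det γ = N. Completing the square, such a form has a
-- rational root iff its discriminant is the square of a rational, i.e. of an integer.
module Submission where

open import Defs
open import Data.Nat using (ℕ; _≤_)
open import Function.Bundles using (_⇔_)

open import Function.Bundles using (mk⇔)
open import Function.Base using (_∘_)
open import Function.Construct.Composition using (_⇔-∘_)
import Data.Nat as ℕ
open import Data.Nat using (suc; ≢-nonZero)
import Data.Nat.Properties as ℕ
import Data.Nat.Divisibility as ℕ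
open import Data.Nat.Divisibility using (divides; ∣-refl)
open import Data.Nat.DivMod using (_/_; m/n*n≡m)
open import Data.Nat.GCD using (gcd; gcd[m,n]≢0; gcd[m,n]∣m; gcd[m,n]∣n)
open import Data.Nat.Coprimality using (Coprime; coprime-/gcd; coprime-divisor)
import Data.Nat.Tactic.RingSolver as ℕ-Solver
open import Data.Integer using (ℤ; +_; -[1+_]; 0ℤ; 1ℤ; -1ℤ; _+_; _-_; _*_; -_; ∣_∣)
import Data.Integer as ℤ
import Data.Integer.Properties as ℤ
import Data.Integer.Tactic.RingSolver as ℤ-Solver
open import Data.Product using (∃; _×_; _,_)
open import Data.Sum using (inj₁; inj₂)
open import Data.Empty using (⊥-elim)
open import Relation.Nullary using (¬_; yes; no)
open import Relation.Binary.PropositionalEquality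

scaledSquare-coprime⇒IsSquare : ∀ D p x → Coprime p x → D ℕ.* (p ℕ.* p) ≡ x ℕ.* x → IsSquare D
scaledSquare-coprime⇒IsSquare D p x coprime eq = x , D≡x²
  where
  p∣x² : p ℕ.∣ x ℕ.* x
  p∣x² = divides (D ℕ.* p) (trans (sym eq) (sym (ℕ.*-assoc D p p)))
  p≡1 : p ≡ 1
  p≡1 = coprime (∣-refl , coprime-divisor coprime p∣x²)
  D≡x² : D ≡ x ℕ.* x
  D≡x² = begin
    D              ≡⟨ sym (ℕ.*-identityʳ D) ⟩
    D ℕ.* (1 ℕ.* 1) ≡⟨ cong (λ u → D ℕ.* (u ℕ.* u)) (sym p≡1) ⟩
    D ℕ.* (p ℕ.* p) ≡⟨ eq ⟩
    x ℕ.* x        ∎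
    where open ≡-Reasoning

square-*-distrib : ∀ u g → (u ℕ.* g) ℕ.* (u ℕ.* g) ≡ (u ℕ.* u) ℕ.* (g ℕ.* g)
square-*-distrib = ℕ-Solver.solve-∀

scaledSquare⇒IsSquare : ∀ D p x → p ≢ 0 → D ℕ.* (p ℕ.* p) ≡ x ℕ.* x → IsSquare D
scaledSquare⇒IsSquare D p x p≢0 eq =
  scaledSquare-coprime⇒IsSquare D p′ x′ (coprime-/gcd p x)
    (ℕ.*-cancelʳ-≡ (D ℕ.* (p′ ℕ.* p′)) (x′ ℕ.* x′) (g ℕ.* g) scaled)
  where
  g = gcd p x
  instance
    g≢0 : ℕ.NonZero g
    g≢0 = ≢-nonZero (gcd[m,n]≢0 p x (inj₁ p≢0))
    g²≢0 : ℕ.NonZero (g ℕ.* g)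
    g²≢0 = ℕ.m*n≢0 g g
  p′ = p / g
  x′ = x / g
  scaled : (D ℕ.* (p′ ℕ.* p′)) ℕ.* (g ℕ.* g) ≡ (x′ ℕ.* x′) ℕ.* (g ℕ.* g)
  scaled = begin
    (D ℕ.* (p′ ℕ.* p′)) ℕ.* (g ℕ.* g) ≡⟨ ℕ.*-assoc D _ _ ⟩
    D ℕ.* ((p′ ℕ.* p′) ℕ.* (g ℕ.* g)) ≡⟨ cong (D ℕ.*_) (sym (square-*-distrib p′ g)) ⟩
    D ℕ.* ((p′ ℕ.* g) ℕ.* (p′ ℕ.* g)) ≡⟨ cong (λ u → D ℕ.* (u ℕ.* u)) (m/n*n≡m (gcd[m,n]∣m p x)) ⟩
    D ℕ.* (p ℕ.* p)                   ≡⟨ eq ⟩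
    x ℕ.* x                           ≡⟨ cong (λ u → u ℕ.* u) (sym (m/n*n≡m (gcd[m,n]∣n p x))) ⟩
    (x′ ℕ.* g) ℕ.* (x′ ℕ.* g)         ≡⟨ square-*-distrib x′ g ⟩
    (x′ ℕ.* x′) ℕ.* (g ℕ.* g)         ∎
    where open ≡-Reasoning

ℤ-scaledSquare⇒IsSquare : ∀ D p X → p ≢ 0ℤ → + D * (p * p) ≡ X * X → IsSquare D
ℤ-scaledSquare⇒IsSquare D p X p≢0 eq =
  scaledSquare⇒IsSquare D ∣ p ∣ ∣ X ∣ (p≢0 ∘ ℤ.∣i∣≡0⇒i≡0) (begin
    D ℕ.* (∣ p ∣ ℕ.* ∣ p ∣) ≡⟨ cong (D ℕ.*_) (sym (ℤ.abs-* p p)) ⟩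
    D ℕ.* ∣ p * p ∣        ≡⟨ sym (ℤ.abs-* (+ D) (p * p)) ⟩
    ∣ + D * (p * p) ∣      ≡⟨ cong ∣_∣ eq ⟩
    ∣ X * X ∣              ≡⟨ ℤ.abs-* X X ⟩
    ∣ X ∣ ℕ.* ∣ X ∣        ∎)
  where open ≡-Reasoning

-- The middle coefficient is even, so the discriminant is B² - A C.
form : ℤ → ℤ → ℤ → ℤ × ℤ → ℤ
form A B C (p , q) = A * (p * p) + + 2 * B * (p * q) + C * (q * q)

Isotropic : ℤ → ℤ → ℤ → Set
Isotropic A B C = ∃ λ x → NonZeroPair x × form A B C x ≡ 0ℤ

completeSquare : ∀ A B C p q → (A * p + B * q) * (A * p + B * q) ≡
  A * (A * (p * p) + + 2 * B * (p * q) + C * (q * q)) + (B * B - A * C) * (q * q)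
completeSquare = ℤ-Solver.solve-∀

form-swap : ∀ A B C p q →
  A * (p * p) + + 2 * B * (p * q) + C * (q * q) ≡ C * (q * q) + + 2 * B * (q * p) + A * (p * p)
form-swap = ℤ-Solver.solve-∀

isotropic⇒scaledSquare : ∀ A B C D p q → form A B C (p , q) ≡ 0ℤ → B * B - A * C ≡ + D →
  + D * (q * q) ≡ (A * p + B * q) * (A * p + B * q)
isotropic⇒scaledSquare A B C D p q form≡0 disc = sym (begin
  (A * p + B * q) * (A * p + B * q)               ≡⟨ completeSquare A B C p q ⟩
  A * form A B C (p , q) + (B * B - A * C) * (q * q) ≡⟨ cong₂ (λ u v → A * u + v * (q * q)) form≡0 disc ⟩
  A * 0ℤ + + D * (q * q)                          ≡⟨ cong (_+ + D * (q * q)) (ℤ.*-zeroʳ A) ⟩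
  0ℤ + + D * (q * q)                              ≡⟨ ℤ.+-identityˡ _ ⟩
  + D * (q * q)                                   ∎)
  where open ≡-Reasoning

isotropic⇒IsSquare : ∀ A B C D → B * B - A * C ≡ + D → Isotropic A B C → IsSquare D
isotropic⇒IsSquare A B C D disc ((p , q) , nonZero , form≡0) with q ℤ.≟ 0ℤ
... | no q≢0 = ℤ-scaledSquare⇒IsSquare D q (A * p + B * q) q≢0
  (isotropic⇒scaledSquare A B C D p q form≡0 disc)
... | yes q≡0 = ℤ-scaledSquare⇒IsSquare D p (C * q + B * p) (λ p≡0 → nonZero (p≡0 , q≡0))
  (isotropic⇒scaledSquare C B A D q p
    (trans (sym (form-swap A B C p q)) form≡0)
    (trans (cong (λ u → B * B - u) (ℤ.*-comm C A)) disc))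

form-at-1,0 : ∀ A B C → A * (1ℤ * 1ℤ) + + 2 * B * (1ℤ * 0ℤ) + C * (0ℤ * 0ℤ) ≡ A
form-at-1,0 = ℤ-Solver.solve-∀

form-at-root : ∀ A B C m → A * ((m - B) * (m - B)) + + 2 * B * ((m - B) * A) + C * (A * A)
  ≡ A * (m * m - (B * B - A * C))
form-at-root = ℤ-Solver.solve-∀

-- When A ≠ 0 the form factors as A⁻¹ (A p + (B - m) q) (A p + (B + m) q), with root (m - B : A).
IsSquare⇒isotropic : ∀ A B C D → B * B - A * C ≡ + D → IsSquare D → Isotropic A B C
IsSquare⇒isotropic A B C D disc (m , D≡m²) with A ℤ.≟ 0ℤ
... | yes A≡0 = (1ℤ , 0ℤ) , (λ ()) , trans (form-at-1,0 A B C) A≡0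
... | no A≢0 = (+ m - B , A) , (λ (_ , A≡0) → A≢0 A≡0) , (begin
  form A B C (+ m - B , A)               ≡⟨ form-at-root A B C (+ m) ⟩
  A * (+ m * + m - (B * B - A * C))      ≡⟨ cong (λ u → A * (+ m * + m - u)) disc ⟩
  A * (+ m * + m - + D)                  ≡⟨ cong (λ u → A * (+ m * + m - + u)) D≡m² ⟩
  A * (+ m * + m - + (m ℕ.* m))          ≡⟨ cong (λ u → A * (+ m * + m - u)) (ℤ.pos-* m m) ⟩
  A * (+ m * + m - + m * + m)            ≡⟨ cong (A *_) (ℤ.+-inverseʳ (+ m * + m)) ⟩
  A * 0ℤ                                 ≡⟨ ℤ.*-zeroʳ A ⟩
  0ℤ                                     ∎)
  where open ≡-Reasoning

isotropic⇔IsSquare : ∀ A B C D → B * B - A * C ≡ + D → Isotropic A B C ⇔ IsSquare D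
isotropic⇔IsSquare A B C D disc = mk⇔ (isotropic⇒IsSquare A B C D disc) (IsSquare⇒isotropic A B C D disc)

W-conj-b : ∀ N γ → Mat.b ((W N · γ) · W N) ≡ Mat.c γ
W-conj-b N (mat a b c d) = identity a b c d
  where
  identity : ∀ a b c d → (0ℤ * a + 1ℤ * c) * 1ℤ + (0ℤ * b + 1ℤ * d) * 0ℤ ≡ c
  identity = ℤ-Solver.solve-∀

W-conj-d : ∀ N γ → Mat.d ((W N · γ) · W N) ≡ + N * Mat.a γ
W-conj-d N (mat a b c d) = identity (+ N) a b c d
  where
  identity : ∀ n a b c d → (n * a + 0ℤ * c) * 1ℤ + (n * b + 0ℤ * d) * 0ℤ ≡ n * a
  identity = ℤ-Solver.solve-∀

i*i≡+∣i∣*∣i∣ : ∀ i → i * i ≡ + (∣ i ∣ ℕ.* ∣ i ∣)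
i*i≡+∣i∣*∣i∣ (+ n)    = sym (ℤ.pos-* n n)
i*i≡+∣i∣*∣i∣ -[1+ n ] = refl

+n*i*i≢-1 : ∀ n i → + n * (i * i) ≢ -1ℤ
+n*i*i≢-1 n i eq with trans (ℤ.pos-* n (∣ i ∣ ℕ.* ∣ i ∣)) (trans (cong (+ n *_) (sym (i*i≡+∣i∣*∣i∣ i))) eq)
... | ()

-- Comparing entries, W γ W = -N adj γ forces a = 0 and c = N b, so that det γ = -N b² ≤ 0.
¬antiAdmissible : ∀ N γ → 1 ≤ N → det γ ≡ 1ℤ → ¬ ((W N · γ) · W N ≡ (- + N) ⊙ adj γ)
¬antiAdmissible N@(suc _) (mat a b c d) _ det≡1 E = +n*i*i≢-1 N b (begin
  + N * (b * b)                            ≡⟨ sym (ℤ.neg-involutive _) ⟩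
  - - (+ N * (b * b))                      ≡⟨ cong -_ (sym (negDet (+ N) b d)) ⟩
  - (0ℤ * d - b * (- + N * - b))           ≡⟨ cong₂ (λ u v → - (u * d - b * v)) (sym a≡0) (sym c≡Nb) ⟩
  - (a * d - b * c)                        ≡⟨ cong -_ det≡1 ⟩
  -1ℤ                                      ∎)
  where
  open ≡-Reasoning
  negDet : ∀ n b d → 0ℤ * d - b * (- n * - b) ≡ - (n * (b * b))
  negDet = ℤ-Solver.solve-∀
  c≡Nb : c ≡ - + N * - b
  c≡Nb = trans (sym (W-conj-b N (mat a b c d))) (cong Mat.b E)
  Na≡-Na : + N * a ≡ - + N * a
  Na≡-Na = trans (sym (W-conj-d N (mat a b c d))) (cong Mat.d E)
  a≡0 : a ≡ 0ℤ
  a≡0 with a ℤ.≟ 0ℤ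
  ... | yes a≡0 = a≡0
  ... | no a≢0 with ℤ.*-cancelʳ-≡ (+ N) (- + N) a {{ℤ.≢-nonZero a≢0}} Na≡-Na
  ...   | ()

admissible⇒c≡-Nb : ∀ N γ → 1 ≤ N → det γ ≡ 1ℤ → Admissible N γ → Mat.c γ ≡ + N * - Mat.b γ
admissible⇒c≡-Nb N γ _   _     (inj₁ E) = trans (sym (W-conj-b N γ)) (cong Mat.b E)
admissible⇒c≡-Nb N γ 1≤N det≡1 (inj₂ E) = ⊥-elim (¬antiAdmissible N γ 1≤N det≡1 E)

cusps⇔isotropic : ∀ N a b d →
  CγHasCusp N (mat a b (+ N * - b) d) ⇔ Isotropic (+ N * a) (+ N * b) (- d)
cusps⇔isotropic N a b d = mk⇔
  (λ ((p , q) , nonZero , fixed) → (p , q) , nonZero ,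
     trans (difference (+ N) a b d p q) (ℤ.i≡j⇒i-j≡0 fixed))
  (λ ((p , q) , nonZero , form≡0) → (p , q) , nonZero ,
     ℤ.i-j≡0⇒i≡j _ _ (trans (sym (difference (+ N) a b d p q)) form≡0))
  where
  difference : ∀ n a b d p q →
    n * a * (p * p) + + 2 * (n * b) * (p * q) + - d * (q * q)
    ≡ (a * p + b * q) * (n * p) - q * (n * - b * p + d * q)
  difference = ℤ-Solver.solve-∀

discriminant≡N : ∀ N a b d → a * d - b * (+ N * - b) ≡ 1ℤ →
  (+ N * b) * (+ N * b) - (+ N * a) * (- d) ≡ + N
discriminant≡N N a b d det≡1 = begin
  (+ N * b) * (+ N * b) - (+ N * a) * (- d) ≡⟨ identity (+ N) a b d ⟩
  + N * (a * d - b * (+ N * - b))           ≡⟨ cong (+ N *_) det≡1 ⟩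
  + N * 1ℤ                                  ≡⟨ ℤ.*-identityʳ (+ N) ⟩
  + N                                       ∎
  where
  open ≡-Reasoning
  identity : ∀ n a b d → (n * b) * (n * b) - (n * a) * (- d) ≡ n * (a * d - b * (n * - b))
  identity = ℤ-Solver.solve-∀

proposition6p5 : (N : ℕ) → 1 ≤ N → (γ : Mat) → InΓ₀ N γ → Admissible N γ →
    CγHasCusp N γ ⇔ IsSquare N
proposition6p5 N 1≤N γ@(mat a b c d) (det≡1 , _) admissible
  with admissible⇒c≡-Nb N γ 1≤N det≡1 admissible
... | refl =
  isotropic⇔IsSquare (+ N * a) (+ N * b) (- d) N (discriminant≡N N a b d det≡1)
    ⇔-∘ cusps⇔isotropic N a b d
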